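{- Let $\mathcal{F}=\langle X,R^+,R^-\rangle$ be a collectively connected symmetric signed frame. Then $\mathcal{F}$ has the local weak balance property if and only if $R^+$ is collusive.
   Context: A symmetric signed frame is a tuple $\langle X,R^+,R^-\rangle$ with $X$ a set and $R^+,R^-\subseteq X\times X$ such that: $R^+$ is reflexive and symmetric; $R^-$ is symmetric; and $\forall x,y\in X.\ \neg(xR^+y)\vee\neg(xR^-y)$. It is collectively connected if moreover $\forall x,y\in X.\ (xR^+y \vee xR^-y)$. It has the local weak balance property iff for all $x,y,z\in X$: (1) $(xR^+y\wedge yR^+z)\Rightarrow xR^+z$, and (2) $((xR^+y\wedge yR^-z)\vee(xR^-y\wedge yR^+z))\Rightarrow xR^-z$. A relation $S$ on $X$ is collusive iff $\forall x,y,z,w\in X\,\big((xSy\wedge xSz\wedge wSy)\Rightarrow wSz\big)$. -}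

module Defs where

open import Level using (Level; _⊔_; suc)
open import Data.Product using (_×_)
open import Data.Sum using (_⊎_)
open import Relation.Nullary using (¬_)
open import Relation.Binary.Core using (Rel)
open import Relation.Binary.Definitions using (Reflexive; Symmetric)
open import Function.Bundles using (_⇔_)

record SymmetricSignedFrame (a ℓ : Level) : Set (suc (a ⊔ ℓ)) where
  field
    X       : Set a
    R⁺      : Rel X ℓ
    R⁻      : Rel X ℓ
    R⁺-refl : Reflexive R⁺
    R⁺-sym  : Symmetric R⁺
    R⁻-sym  : Symmetric R⁻
    disjoint : ∀ x y → ¬ R⁺ x y ⊎ ¬ R⁻ x y

module _ {a ℓ : Level} (F : SymmetricSignedFrame a ℓ) where
  open SymmetricSignedFrame F

  CollectivelyConnected : Set (a ⊔ ℓ)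
  CollectivelyConnected = ∀ x y → R⁺ x y ⊎ R⁻ x y

  LocalWeakBalance : Set (a ⊔ ℓ)
  LocalWeakBalance =
    (∀ x y z → R⁺ x y × R⁺ y z → R⁺ x z) ×
    (∀ x y z → (R⁺ x y × R⁻ y z) ⊎ (R⁻ x y × R⁺ y z) → R⁻ x z)

Collusive : {a ℓ : Level} {A : Set a} → Rel A ℓ → Set (a ⊔ ℓ)
Collusive S = ∀ x y z w → S x y × S x z × S w y → S w z

-- In a collectively connected frame every pair of points is related by exactly one of R⁺, R⁻,
-- so the negative clause of local weak balance follows from the positive one: if R⁺ x z held,
-- transitivity would put the R⁻-edge of the hypothesis inside R⁺. Local weak balance thus
-- amounts to transitivity of R⁺, and for a reflexive symmetric relation transitivity is
-- equivalent to collusiveness.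
module Submission where

open import Defs
open import Level using (Level)
open import Function.Bundles using (_⇔_; mk⇔)
open import Function.Properties.Equivalence using () renaming (trans to ⇔-trans; sym to ⇔-sym)
open import Data.Product using (_×_; _,_)
open import Data.Sum using (_⊎_; inj₁; inj₂)
open import Relation.Nullary using (¬_; contradiction)
open import Relation.Binary.Core using (Rel)
open import Relation.Binary.Definitions using (Reflexive; Symmetric; Transitive)

module _ {a ℓ : Level} {A : Set a} {S : Rel A ℓ} where

  transitive⇒collusive : Symmetric S → Transitive S → Collusive S
  transitive⇒collusive sym trans x y z w (xy , xz , wy) = trans (trans wy (sym xy)) xz

  collusive⇒transitive : Reflexive S → Symmetric S → Collusive S → Transitive S
  collusive⇒transitive refl sym col {x} {y} {z} xy yz = col y x z x (sym xy , yz , refl)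

  collusive⇔transitive : Reflexive S → Symmetric S → Collusive S ⇔ Transitive S
  collusive⇔transitive refl sym =
    mk⇔ (collusive⇒transitive refl sym) (transitive⇒collusive sym)

module _ {a ℓ : Level} (F : SymmetricSignedFrame a ℓ) where
  open SymmetricSignedFrame F

  R⁺⇒¬R⁻ : ∀ {x y} → R⁺ x y → ¬ R⁻ x y
  R⁺⇒¬R⁻ {x} {y} p n with disjoint x y
  ... | inj₁ ¬p = ¬p p
  ... | inj₂ ¬n = ¬n n

  R⁻-absorbs-R⁺ : CollectivelyConnected F → Transitive R⁺ →
    ∀ x y z → (R⁺ x y × R⁻ y z) ⊎ (R⁻ x y × R⁺ y z) → R⁻ x z
  R⁻-absorbs-R⁺ connected trans x y z h with connected x z
  ... | inj₂ xz = xz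
  R⁻-absorbs-R⁺ connected trans x y z (inj₁ (xy , yz)) | inj₁ xz =
    contradiction yz (R⁺⇒¬R⁻ (trans (R⁺-sym xy) xz))
  R⁻-absorbs-R⁺ connected trans x y z (inj₂ (xy , yz)) | inj₁ xz =
    contradiction xy (R⁺⇒¬R⁻ (trans xz (R⁺-sym yz)))

  localWeakBalance⇔transitive : CollectivelyConnected F → LocalWeakBalance F ⇔ Transitive R⁺
  localWeakBalance⇔transitive connected = mk⇔ to from
    where
    to : LocalWeakBalance F → Transitive R⁺
    to (trans , _) {x} {y} {z} xy yz = trans x y z (xy , yz)

    from : Transitive R⁺ → LocalWeakBalance F
    from trans = (λ x y z (xy , yz) → trans xy yz) , R⁻-absorbs-R⁺ connected trans

mainTheorem9 : {a ℓ : Level} (F : SymmetricSignedFrame a ℓ) →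
    CollectivelyConnected F →
    (LocalWeakBalance F ⇔ Collusive (SymmetricSignedFrame.R⁺ F))
mainTheorem9 F connected =
  ⇔-trans (localWeakBalance⇔transitive F connected)
          (⇔-sym (collusive⇔transitive R⁺-refl R⁺-sym))
  where open SymmetricSignedFrame F
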